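{- Let $b\ge2$ and let $n=x+by$, with $0\le x,y\le b-1$, be a non-trivial $1$-cycle of $S_{x^2,b}$, and let $d=\gcd(b^2+1,n)$. Then $d>1$, and $N=x+b(b-y)$ is another $1$-cycle of $S_{x^2,b}$ such that, with $D=\gcd(b^2+1,N)$, we have $D>1$ and $b^2+1=dD$. Moreover, setting $g=\gcd(x,y)$, $g'=\gcd(x,b-y)$, $h=\gcd(x-1,y)$ and $h'=\gcd(x-1,b-y)$, we have: (a) $x=gg'$, $y=gh$, $b-y=g'h'$, and $x-1=hh'$; (b) $d=n/g^2$ and $D=N/g'^2$.
   Context: For an integer $b\ge2$, $S_{x^2,b}(n)=x_0^2+\dots+x_k^2$ where $n=x_0+x_1b+\dots+x_kb^k$ is the base-$b$ expansion of $n\ge0$. A $1$-cycle of $S_{x^2,b}$ is a positive integer $n$ with $S_{x^2,b}(n)=n$; it is non-trivial if $n\neq1$. -}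

module Defs where

open import Data.Nat using (ℕ; zero; suc; _+_; _*_; _^_)
open import Data.Nat.DivMod using (_/_; _%_)
open import Data.Nat using (_<_)
open import Relation.Binary.PropositionalEquality using (_≡_)

sqDigitsFuel : ℕ → (k : ℕ) → ℕ → ℕ
sqDigitsFuel zero    k n = 0
sqDigitsFuel (suc f) k n = (n % suc (suc k)) ^ 2 + sqDigitsFuel f k (n / suc (suc k))

-- Fuel n suffices since for b ≥ 2 each step strictly decreases a positive n.
-- Only meaningful for b ≥ 2; for b < 2 it returns the junk value 0.
S : (b : ℕ) → ℕ → ℕ
S zero          n = 0
S (suc zero)    n = 0
S (suc (suc k)) n = sqDigitsFuel n k n

record OneCycle (b n : ℕ) : Set where
  field
    positive : 0 < n
    fixed    : S b n ≡ n

{-# OPTIONS --safe #-}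
-- The fixed-point equation x² + y² = x + by says x(x − 1) = y(b − y). Since x and x − 1 are
-- coprime, the four gcds g = (x, y), g' = (x, b − y), h = (x − 1, y), h' = (x − 1, b − y)
-- factor x = gg', y = gh, b − y = g'h', x − 1 = hh'; in particular gg' − hh' = 1. The
-- Brahmagupta identity then gives b² + 1 = (gh + g'h')² + (gg' − hh')² = (g'² + h²)(g² + h'²),
-- while n = g²(g'² + h²) and N = g'²(g² + h'²). As g ⊥ h' and g' ⊥ h, the factor g² + h'² is
-- coprime to g² and g'² + h² to g'², so d = g'² + h² and D = g² + h'².
module Submission where

open import Defs
open import Data.Nat using (ℕ; zero; suc; _+_; _*_; _∸_; _^_; _≤_; _<_; z≤n; s≤s; NonZero; ≢-nonZero; ≢-nonZero⁻¹; >-nonZero; >-nonZero⁻¹)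
open import Data.Nat.Properties
open import Data.Nat.DivMod using (_/_; _%_; m<n⇒m%n≡m; m<n⇒m/n≡0; [m+kn]%n≡m%n; +-distrib-/-∣ʳ; m*n/n≡m; m*[n/m]≡n)
open import Data.Nat.Divisibility using (_∣_; divides; quotient; n∣m*n; ∣-trans; ∣1⇒≡1; ∣m+n∣m⇒∣n; ∣m⇒∣m*n; ∣n⇒∣m*n; m∣n⇒n≡m*quotient)
open import Data.Nat.GCD using (gcd; gcd[m,n]∣m; gcd[m,n]∣n; gcd[m,n]≢0; c*gcd[m,n]≡gcd[cm,cn])
open import Data.Nat.Coprimality using (Coprime; coprime⇒gcd≡1; coprime-/gcd; coprime-divisor; coprime-factors; coprime-+; 1-coprimeTo)
  renaming (sym to ⊥-sym)
open import Data.Nat.Solver using (module +-*-Solver)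
open import Algebra.Properties.CommutativeSemigroup *-commutativeSemigroup using (x∙yz≈y∙xz)
open import Data.Product using (_×_; _,_)
open import Data.Sum using (inj₁; inj₂)
open import Function.Bundles using (_⇔_; mk⇔; Equivalence)
open import Relation.Binary.PropositionalEquality using (_≡_; _≢_; ≢-sym; refl; sym; trans; cong; cong₂; subst; module ≡-Reasoning)
open import Relation.Nullary using (contradiction)

open +-*-Solver using (solve; _:+_; _:*_; _:^_; _:=_; con)
open ≡-Reasoning

sqDigitsFuel-zero : ∀ f k → sqDigitsFuel f k 0 ≡ 0
sqDigitsFuel-zero zero    k = refl
sqDigitsFuel-zero (suc f) k = sqDigitsFuel-zero f k

sqDigitsFuel-digit+ : ∀ f k {x} m → x < suc (suc k) →
  sqDigitsFuel (suc f) k (x + suc (suc k) * m) ≡ x ^ 2 + sqDigitsFuel f k m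
sqDigitsFuel-digit+ f k {x} m x<b =
  cong₂ (λ r q → r ^ 2 + sqDigitsFuel f k q) [x+bm]%b≡x [x+bm]/b≡m
  where
  b = suc (suc k)
  [x+bm]%b≡x : (x + b * m) % b ≡ x
  [x+bm]%b≡x = begin
    (x + b * m) % b ≡⟨ cong (λ t → (x + t) % b) (*-comm b m) ⟩
    (x + m * b) % b ≡⟨ [m+kn]%n≡m%n x m b ⟩
    x % b           ≡⟨ m<n⇒m%n≡m x<b ⟩
    x               ∎
  [x+bm]/b≡m : (x + b * m) / b ≡ m
  [x+bm]/b≡m = begin
    (x + b * m) / b   ≡⟨ cong (λ t → (x + t) / b) (*-comm b m) ⟩
    (x + m * b) / b   ≡⟨ +-distrib-/-∣ʳ x (n∣m*n m) ⟩
    x / b + m * b / b ≡⟨ cong₂ _+_ (m<n⇒m/n≡0 x<b) (m*n/n≡m m b) ⟩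
    m                 ∎

sqDigitsFuel-digit : ∀ f k {x} → x < suc (suc k) → sqDigitsFuel (suc f) k x ≡ x ^ 2
sqDigitsFuel-digit f k {x} x<b = begin
  sqDigitsFuel (suc f) k x                  ≡⟨ cong (sqDigitsFuel (suc f) k) x≡x+b*0 ⟩
  sqDigitsFuel (suc f) k (x + suc (suc k) * 0) ≡⟨ sqDigitsFuel-digit+ f k 0 x<b ⟩
  x ^ 2 + sqDigitsFuel f k 0                ≡⟨ cong (x ^ 2 +_) (sqDigitsFuel-zero f k) ⟩
  x ^ 2 + 0                                 ≡⟨ +-identityʳ (x ^ 2) ⟩
  x ^ 2                                     ∎
  where
  x≡x+b*0 : x ≡ x + suc (suc k) * 0
  x≡x+b*0 = sym (trans (cong (x +_) (*-zeroʳ (suc (suc k)))) (+-identityʳ x))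

S-twoDigits : ∀ {b x y} → 2 ≤ b → x < b → y < b → 2 ≤ x + b * y →
  S b (x + b * y) ≡ x ^ 2 + y ^ 2
S-twoDigits {suc (suc k)} {x} {y} (s≤s (s≤s _)) x<b y<b 2≤n =
  subst (λ f → sqDigitsFuel f k n ≡ x ^ 2 + y ^ 2) (m+[n∸m]≡n 2≤n) (begin
    sqDigitsFuel (2 + (n ∸ 2)) k n             ≡⟨ sqDigitsFuel-digit+ (suc (n ∸ 2)) k y x<b ⟩
    x ^ 2 + sqDigitsFuel (1 + (n ∸ 2)) k y     ≡⟨ cong (x ^ 2 +_) (sqDigitsFuel-digit (n ∸ 2) k y<b) ⟩
    x ^ 2 + y ^ 2                              ∎)
  where
  n = x + suc (suc k) * y

twoDigitFixedPoint⇔cycleEquation : ∀ {b x y c} → b ≡ y + c →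
  (x ^ 2 + y ^ 2 ≡ x + b * y) ⇔ (x ^ 2 ≡ x + y * c)
twoDigitFixedPoint⇔cycleEquation {x = x} {y} {c} refl = mk⇔
  (λ fixed → +-cancelʳ-≡ (y ^ 2) (x ^ 2) (x + y * c) (trans fixed regroup))
  (λ eq → trans (cong (_+ y ^ 2) eq) (sym regroup))
  where
  regroup : x + (y + c) * y ≡ x + y * c + y ^ 2
  regroup = solve 3 (λ x y c → x :+ (y :+ c) :* y := x :+ y :* c :+ y :^ 2) refl x y c

x^2≡x⇒x≤1 : ∀ {x} → x ^ 2 ≡ x → x ≤ 1
x^2≡x⇒x≤1 {zero}  _  = z≤n
x^2≡x⇒x≤1 {suc x} eq = ≤-reflexive (begin
  suc x       ≡⟨ sym (*-identityʳ (suc x)) ⟩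
  suc x * 1   ≡⟨ *-cancelˡ-≡ (suc x * 1) 1 (suc x) (trans eq (sym (*-identityʳ (suc x)))) ⟩
  1           ∎)

cycleEquation-nontrivial⇒0<y : ∀ {b x y c} → x ^ 2 ≡ x + y * c → 2 ≤ x + b * y → 0 < y
cycleEquation-nontrivial⇒0<y {y = suc _} _ _ = s≤s z≤n
cycleEquation-nontrivial⇒0<y {b} {x} {zero} eq 2≤n =
  contradiction (≤-trans 2≤n (≤-reflexive x+b*0≡x)) (<⇒≱ (s≤s (x^2≡x⇒x≤1 (trans eq (+-identityʳ x)))))
  where
  x+b*0≡x : x + b * 0 ≡ x
  x+b*0≡x = trans (cong (x +_) (*-zeroʳ b)) (+-identityʳ x)

cycleEquation⇒nonZero : ∀ {x m} .{{_ : NonZero m}} → x ^ 2 ≡ x + m → NonZero x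
cycleEquation⇒nonZero {zero} {m} eq = contradiction (sym eq) (≢-nonZero⁻¹ m)
cycleEquation⇒nonZero {suc _} _ = _

cycleEquation⇒x[x∸1]≡ : ∀ {x m} → x ^ 2 ≡ x + m → x * (x ∸ 1) ≡ m
cycleEquation⇒x[x∸1]≡ {zero}  eq = eq
cycleEquation⇒x[x∸1]≡ {suc a} {m} eq = +-cancelˡ-≡ (suc a) (suc a * a) m (begin
  suc a + suc a * a ≡⟨ solve 1 (λ a → con 1 :+ a :+ (con 1 :+ a) :* a := (con 1 :+ a) :^ 2) refl a ⟩
  suc a ^ 2         ≡⟨ eq ⟩
  suc a + m         ∎)

twoDigitCycle : ∀ {b x y} → 2 ≤ b → x < b → y < b → .{{_ : NonZero y}} →
  x ^ 2 + y ^ 2 ≡ x + b * y → OneCycle b (x + b * y)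
twoDigitCycle {b} {x} {y} 2≤b x<b y<b fixed = record
  { positive = ≤-trans (s≤s z≤n) 2≤n
  ; fixed    = trans (S-twoDigits 2≤b x<b y<b 2≤n) fixed
  }
  where
  2≤n : 2 ≤ x + b * y
  2≤n = ≤-trans 2≤b (≤-trans (m≤m*n b y) (m≤n+m (b * y) x))

coprime-*ˡ : ∀ {m n o} → Coprime m o → Coprime n o → Coprime (m * n) o
coprime-*ˡ {n = n} m⊥o n⊥o (d∣mn , d∣o) = n⊥o (coprime-factors m⊥o (d∣mn , ∣m⇒∣m*n n d∣o) , d∣o)

coprime-^ˡ : ∀ {m n} i → Coprime m n → Coprime (m ^ i) n
coprime-^ˡ {n = n} zero    _   = 1-coprimeTo n
coprime-^ˡ         (suc i) m⊥n = coprime-*ˡ m⊥n (coprime-^ˡ i m⊥n)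

coprime-^2 : ∀ {m n} → Coprime m n → Coprime (m ^ 2) (n ^ 2)
coprime-^2 m⊥n = ⊥-sym (coprime-^ˡ 2 (⊥-sym (coprime-^ˡ 2 m⊥n)))

coprime-∣ : ∀ {m m′ n n′} → m ∣ m′ → n ∣ n′ → Coprime m′ n′ → Coprime m n
coprime-∣ m∣m′ n∣n′ m′⊥n′ (d∣m , d∣n) = m′⊥n′ (∣-trans d∣m m∣m′ , ∣-trans d∣n n∣n′)

n⊥n∸1 : ∀ {n} .{{_ : NonZero n}} → Coprime n (n ∸ 1)
n⊥n∸1 {suc n} {d} (d∣1+n , d∣n) = ∣1⇒≡1 (∣m+n∣m⇒∣n (subst (d ∣_) (+-comm 1 n) d∣1+n) d∣n)

coprime⇒gcd[cm,cn]≡c : ∀ c {m n} → Coprime m n → gcd (c * m) (c * n) ≡ c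
coprime⇒gcd[cm,cn]≡c c {m} {n} m⊥n = begin
  gcd (c * m) (c * n) ≡⟨ sym (c*gcd[m,n]≡gcd[cm,cn] c m n) ⟩
  c * gcd m n         ≡⟨ cong (c *_) (coprime⇒gcd≡1 m⊥n) ⟩
  c * 1               ≡⟨ *-identityʳ c ⟩
  c                   ∎

gcd≢0ˡ : ∀ m n .{{_ : NonZero m}} → NonZero (gcd m n)
gcd≢0ˡ m n = ≢-nonZero (gcd[m,n]≢0 m n (inj₁ (≢-nonZero⁻¹ m)))

gcd≢0ʳ : ∀ m n .{{_ : NonZero n}} → NonZero (gcd m n)
gcd≢0ʳ m n = ≢-nonZero (gcd[m,n]≢0 m n (inj₂ (≢-nonZero⁻¹ n)))

-- The four-number theorem; coprimality of x and a makes its four factors the pairwise gcds.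
module CoprimeProduct {x y a c : ℕ} .{{_ : NonZero x}} (x⊥a : Coprime x a) (xa≡yc : x * a ≡ y * c) where

  private
    g = gcd x y
    instance
      g≢0 : NonZero g
      g≢0 = gcd≢0ˡ x y
    u = x / g
    v = y / g

    x≡gu : x ≡ g * u
    x≡gu = sym (m*[n/m]≡n (gcd[m,n]∣m x y))

    y≡gv : y ≡ g * v
    y≡gv = sym (m*[n/m]≡n (gcd[m,n]∣n x y))

    u⊥v : Coprime u v
    u⊥v = coprime-/gcd x y

    instance
      u≢0 : NonZero u
      u≢0 = ≢-nonZero λ u≡0 → ≢-nonZero⁻¹ x (trans x≡gu (trans (cong (g *_) u≡0) (*-zeroʳ g)))

    ua≡vc : u * a ≡ v * c
    ua≡vc = *-cancelˡ-≡ (u * a) (v * c) g (begin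
      g * (u * a) ≡⟨ sym (*-assoc g u a) ⟩
      g * u * a   ≡⟨ cong (_* a) (sym x≡gu) ⟩
      x * a       ≡⟨ xa≡yc ⟩
      y * c       ≡⟨ cong (_* c) y≡gv ⟩
      g * v * c   ≡⟨ *-assoc g v c ⟩
      g * (v * c) ∎)

    u∣c : u ∣ c
    u∣c = coprime-divisor u⊥v (divides a (trans (sym ua≡vc) (*-comm u a)))

    k = quotient u∣c

    c≡uk : c ≡ u * k
    c≡uk = m∣n⇒n≡m*quotient u∣c

    a≡vk : a ≡ v * k
    a≡vk = *-cancelˡ-≡ a (v * k) u (trans ua≡vc (trans (cong (v *_) c≡uk) (x∙yz≈y∙xz v u k)))

    g⊥k : Coprime g k
    g⊥k = coprime-∣ (gcd[m,n]∣m x y) (divides v a≡vk) x⊥a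

    gcd[x,c]≡u : gcd x c ≡ u
    gcd[x,c]≡u = trans (cong₂ gcd (trans x≡gu (*-comm g u)) c≡uk) (coprime⇒gcd[cm,cn]≡c u g⊥k)

    gcd[a,y]≡v : gcd a y ≡ v
    gcd[a,y]≡v = trans (cong₂ gcd a≡vk (trans y≡gv (*-comm g v))) (coprime⇒gcd[cm,cn]≡c v (⊥-sym g⊥k))

    gcd[a,c]≡k : gcd a c ≡ k
    gcd[a,c]≡k = trans (cong₂ gcd (trans a≡vk (*-comm v k)) (trans c≡uk (*-comm u k)))
                       (coprime⇒gcd[cm,cn]≡c k (⊥-sym u⊥v))

  x≡gcd[x,y]*gcd[x,c] : x ≡ gcd x y * gcd x c
  x≡gcd[x,y]*gcd[x,c] = trans x≡gu (cong (g *_) (sym gcd[x,c]≡u))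

  y≡gcd[x,y]*gcd[a,y] : y ≡ gcd x y * gcd a y
  y≡gcd[x,y]*gcd[a,y] = trans y≡gv (cong (g *_) (sym gcd[a,y]≡v))

  c≡gcd[x,c]*gcd[a,c] : c ≡ gcd x c * gcd a c
  c≡gcd[x,c]*gcd[a,c] = trans c≡uk (sym (cong₂ _*_ gcd[x,c]≡u gcd[a,c]≡k))

  a≡gcd[a,y]*gcd[a,c] : a ≡ gcd a y * gcd a c
  a≡gcd[a,y]*gcd[a,c] = trans a≡vk (sym (cong₂ _*_ gcd[a,y]≡v gcd[a,c]≡k))

1<m²+n² : ∀ m n .{{_ : NonZero m}} .{{_ : NonZero n}} → 1 < m ^ 2 + n ^ 2
1<m²+n² m n = +-mono-≤ (m^n>0 m 2) (m^n>0 n 2)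

-- With gu − vk = 1, the Brahmagupta identity (gv + uk)² + (gu − vk)² = (u² + v²)(g² + k²)
-- factors b² + 1.
module UnitDeterminant {g u v k : ℕ} (det : g * u ≡ 1 + v * k) where

  b n N : ℕ
  b = g * v + u * k
  n = g * u + b * (g * v)
  N = g * u + b * (u * k)

  private
    divides-det⇒≡1 : ∀ {d} → d ∣ g * u → d ∣ v * k → d ≡ 1
    divides-det⇒≡1 {d} d∣gu d∣vk =
      ∣1⇒≡1 (∣m+n∣m⇒∣n (subst (d ∣_) (trans det (+-comm 1 (v * k))) d∣gu) d∣vk)

  g⊥k : Coprime g k
  g⊥k (d∣g , d∣k) = divides-det⇒≡1 (∣m⇒∣m*n u d∣g) (∣n⇒∣m*n v d∣k)

  u⊥v : Coprime u v
  u⊥v (d∣u , d∣v) = divides-det⇒≡1 (∣n⇒∣m*n g d∣u) (∣m⇒∣m*n k d∣v)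

  b²+1≡[u²+v²][g²+k²] : b ^ 2 + 1 ≡ (u ^ 2 + v ^ 2) * (g ^ 2 + k ^ 2)
  b²+1≡[u²+v²][g²+k²] = +-cancelʳ-≡ (2 * (1 + t) * t) (b ^ 2 + 1) ((u ^ 2 + v ^ 2) * (g ^ 2 + k ^ 2)) (begin
    b ^ 2 + 1 + 2 * (1 + t) * t             ≡⟨ solve 2 (λ b t → b :^ 2 :+ con 1 :+ con 2 :* (con 1 :+ t) :* t
                                                          := b :^ 2 :+ (con 1 :+ t) :^ 2 :+ t :^ 2) refl b t ⟩
    b ^ 2 + (1 + t) ^ 2 + t ^ 2             ≡⟨ cong (λ s → b ^ 2 + s ^ 2 + t ^ 2) (sym det) ⟩
    b ^ 2 + (g * u) ^ 2 + t ^ 2             ≡⟨ solve 4 (λ g u v k → (g :* v :+ u :* k) :^ 2 :+ (g :* u) :^ 2 :+ (v :* k) :^ 2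
                                                          := (u :^ 2 :+ v :^ 2) :* (g :^ 2 :+ k :^ 2) :+ con 2 :* (g :* u) :* (v :* k))
                                                     refl g u v k ⟩
    (u ^ 2 + v ^ 2) * (g ^ 2 + k ^ 2) + 2 * (g * u) * t ≡⟨ cong (λ s → (u ^ 2 + v ^ 2) * (g ^ 2 + k ^ 2) + 2 * s * t) det ⟩
    (u ^ 2 + v ^ 2) * (g ^ 2 + k ^ 2) + 2 * (1 + t) * t ∎)
    where
    t = v * k

  n≡[u²+v²]g² : n ≡ (u ^ 2 + v ^ 2) * g ^ 2
  n≡[u²+v²]g² = begin
    g * u + b * (g * v)           ≡⟨ solve 4 (λ g u v k → g :* u :+ (g :* v :+ u :* k) :* (g :* v)
                                                := g :* u :* (con 1 :+ v :* k) :+ (g :* v) :^ 2) refl g u v k ⟩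
    g * u * (1 + v * k) + (g * v) ^ 2 ≡⟨ cong (λ s → g * u * s + (g * v) ^ 2) (sym det) ⟩
    g * u * (g * u) + (g * v) ^ 2 ≡⟨ solve 3 (λ g u v → g :* u :* (g :* u) :+ (g :* v) :^ 2
                                                := (u :^ 2 :+ v :^ 2) :* g :^ 2) refl g u v ⟩
    (u ^ 2 + v ^ 2) * g ^ 2       ∎

  N≡[g²+k²]u² : N ≡ (g ^ 2 + k ^ 2) * u ^ 2
  N≡[g²+k²]u² = begin
    g * u + b * (u * k)           ≡⟨ solve 4 (λ g u v k → g :* u :+ (g :* v :+ u :* k) :* (u :* k)
                                                := g :* u :* (con 1 :+ v :* k) :+ (u :* k) :^ 2) refl g u v k ⟩
    g * u * (1 + v * k) + (u * k) ^ 2 ≡⟨ cong (λ s → g * u * s + (u * k) ^ 2) (sym det) ⟩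
    g * u * (g * u) + (u * k) ^ 2 ≡⟨ solve 3 (λ g u k → g :* u :* (g :* u) :+ (u :* k) :^ 2
                                                := (g :^ 2 :+ k :^ 2) :* u :^ 2) refl g u k ⟩
    (g ^ 2 + k ^ 2) * u ^ 2       ∎

  gcd[b²+1,n]≡u²+v² : gcd (b ^ 2 + 1) n ≡ u ^ 2 + v ^ 2
  gcd[b²+1,n]≡u²+v² = trans (cong₂ gcd b²+1≡[u²+v²][g²+k²] n≡[u²+v²]g²)
                            (coprime⇒gcd[cm,cn]≡c (u ^ 2 + v ^ 2) (coprime-+ (coprime-^2 (⊥-sym g⊥k))))

  gcd[b²+1,N]≡g²+k² : gcd (b ^ 2 + 1) N ≡ g ^ 2 + k ^ 2
  gcd[b²+1,N]≡g²+k² = trans (cong₂ gcd (trans b²+1≡[u²+v²][g²+k²] (*-comm (u ^ 2 + v ^ 2) _)) N≡[g²+k²]u²)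
                            (coprime⇒gcd[cm,cn]≡c (g ^ 2 + k ^ 2) (coprime-+ (coprime-^2 (⊥-sym u⊥v))))

module CycleEquation {b x y c : ℕ} .{{_ : NonZero y}} .{{_ : NonZero c}}
                     (b≡y+c : b ≡ y + c) (cycleEq : x ^ 2 ≡ x + y * c) where

  private
    instance
      yc≢0 : NonZero (y * c)
      yc≢0 = m*n≢0 y c
      x≢0 : NonZero x
      x≢0 = cycleEquation⇒nonZero cycleEq

  open CoprimeProduct {x} {y} {x ∸ 1} {c} n⊥n∸1 (cycleEquation⇒x[x∸1]≡ cycleEq) public

  private
    g = gcd x y
    u = gcd x c
    v = gcd (x ∸ 1) y
    k = gcd (x ∸ 1) c

    instance
      g≢0 : NonZero g
      g≢0 = gcd≢0ˡ x y
      u≢0 : NonZero u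
      u≢0 = gcd≢0ˡ x c
      v≢0 : NonZero v
      v≢0 = gcd≢0ʳ (x ∸ 1) y
      k≢0 : NonZero k
      k≢0 = gcd≢0ʳ (x ∸ 1) c

    det : g * u ≡ 1 + v * k
    det = begin
      g * u       ≡⟨ sym x≡gcd[x,y]*gcd[x,c] ⟩
      x           ≡⟨ sym (m+[n∸m]≡n (>-nonZero⁻¹ x)) ⟩
      1 + (x ∸ 1) ≡⟨ cong (1 +_) a≡gcd[a,y]*gcd[a,c] ⟩
      1 + v * k   ∎

    module D = UnitDeterminant {g} {u} {v} {k} det

    b≡D-b : b ≡ D.b
    b≡D-b = trans b≡y+c (cong₂ _+_ y≡gcd[x,y]*gcd[a,y] c≡gcd[x,c]*gcd[a,c])

    b²+1≡D-b²+1 : b ^ 2 + 1 ≡ D.b ^ 2 + 1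
    b²+1≡D-b²+1 = cong (λ s → s ^ 2 + 1) b≡D-b

    gcd[b²+1,x+by]≡u²+v² : gcd (b ^ 2 + 1) (x + b * y) ≡ u ^ 2 + v ^ 2
    gcd[b²+1,x+by]≡u²+v² =
      trans (cong₂ gcd b²+1≡D-b²+1 (cong₂ _+_ x≡gcd[x,y]*gcd[x,c] (cong₂ _*_ b≡D-b y≡gcd[x,y]*gcd[a,y])))
            D.gcd[b²+1,n]≡u²+v²

    gcd[b²+1,x+bc]≡g²+k² : gcd (b ^ 2 + 1) (x + b * c) ≡ g ^ 2 + k ^ 2
    gcd[b²+1,x+bc]≡g²+k² =
      trans (cong₂ gcd b²+1≡D-b²+1 (cong₂ _+_ x≡gcd[x,y]*gcd[x,c] (cong₂ _*_ b≡D-b c≡gcd[x,c]*gcd[a,c])))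
            D.gcd[b²+1,N]≡g²+k²

  1<gcd[b²+1,x+by] : 1 < gcd (b ^ 2 + 1) (x + b * y)
  1<gcd[b²+1,x+by] = subst (1 <_) (sym gcd[b²+1,x+by]≡u²+v²) (1<m²+n² u v)

  1<gcd[b²+1,x+bc] : 1 < gcd (b ^ 2 + 1) (x + b * c)
  1<gcd[b²+1,x+bc] = subst (1 <_) (sym gcd[b²+1,x+bc]≡g²+k²) (1<m²+n² g k)

  b²+1≡gcd[b²+1,x+by]*gcd[b²+1,x+bc] : b ^ 2 + 1 ≡ gcd (b ^ 2 + 1) (x + b * y) * gcd (b ^ 2 + 1) (x + b * c)
  b²+1≡gcd[b²+1,x+by]*gcd[b²+1,x+bc] = begin
    b ^ 2 + 1                         ≡⟨ b²+1≡D-b²+1 ⟩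
    D.b ^ 2 + 1                       ≡⟨ D.b²+1≡[u²+v²][g²+k²] ⟩
    (u ^ 2 + v ^ 2) * (g ^ 2 + k ^ 2) ≡⟨ sym (cong₂ _*_ gcd[b²+1,x+by]≡u²+v² gcd[b²+1,x+bc]≡g²+k²) ⟩
    gcd (b ^ 2 + 1) (x + b * y) * gcd (b ^ 2 + 1) (x + b * c) ∎

  x+by≡gcd[b²+1,x+by]*gcd[x,y]² : x + b * y ≡ gcd (b ^ 2 + 1) (x + b * y) * gcd x y ^ 2
  x+by≡gcd[b²+1,x+by]*gcd[x,y]² = begin
    x + b * y               ≡⟨ cong₂ _+_ x≡gcd[x,y]*gcd[x,c] (cong₂ _*_ b≡D-b y≡gcd[x,y]*gcd[a,y]) ⟩
    D.n                     ≡⟨ D.n≡[u²+v²]g² ⟩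
    (u ^ 2 + v ^ 2) * g ^ 2 ≡⟨ cong (_* g ^ 2) (sym gcd[b²+1,x+by]≡u²+v²) ⟩
    gcd (b ^ 2 + 1) (x + b * y) * g ^ 2 ∎

  x+bc≡gcd[b²+1,x+bc]*gcd[x,c]² : x + b * c ≡ gcd (b ^ 2 + 1) (x + b * c) * gcd x c ^ 2
  x+bc≡gcd[b²+1,x+bc]*gcd[x,c]² = begin
    x + b * c               ≡⟨ cong₂ _+_ x≡gcd[x,y]*gcd[x,c] (cong₂ _*_ b≡D-b c≡gcd[x,c]*gcd[a,c]) ⟩
    D.N                     ≡⟨ D.N≡[g²+k²]u² ⟩
    (g ^ 2 + k ^ 2) * u ^ 2 ≡⟨ cong (_* u ^ 2) (sym gcd[b²+1,x+bc]≡g²+k²) ⟩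
    gcd (b ^ 2 + 1) (x + b * c) * u ^ 2 ∎

proposition4p1 : (b x y : ℕ) → 2 ≤ b → x < b → y < b →
    OneCycle b (x + b * y) → x + b * y ≢ 1 →
      (1 < gcd (b ^ 2 + 1) (x + b * y))
      × OneCycle b (x + b * (b ∸ y))
      × (1 < gcd (b ^ 2 + 1) (x + b * (b ∸ y)))
      × (b ^ 2 + 1 ≡ gcd (b ^ 2 + 1) (x + b * y) * gcd (b ^ 2 + 1) (x + b * (b ∸ y)))
      × (x ≡ gcd x y * gcd x (b ∸ y))
      × (y ≡ gcd x y * gcd (x ∸ 1) y)
      × (b ∸ y ≡ gcd x (b ∸ y) * gcd (x ∸ 1) (b ∸ y))
      × (x ∸ 1 ≡ gcd (x ∸ 1) y * gcd (x ∸ 1) (b ∸ y))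
      × (x + b * y ≡ gcd (b ^ 2 + 1) (x + b * y) * gcd x y ^ 2)
      × (x + b * (b ∸ y) ≡ gcd (b ^ 2 + 1) (x + b * (b ∸ y)) * gcd x (b ∸ y) ^ 2)
proposition4p1 b x y 2≤b x<b y<b cycle n≢1 =
  1<gcd[b²+1,x+by] , cycle′ , 1<gcd[b²+1,x+bc] , b²+1≡gcd[b²+1,x+by]*gcd[b²+1,x+bc] ,
  x≡gcd[x,y]*gcd[x,c] , y≡gcd[x,y]*gcd[a,y] , c≡gcd[x,c]*gcd[a,c] , a≡gcd[a,y]*gcd[a,c] ,
  x+by≡gcd[b²+1,x+by]*gcd[x,y]² , x+bc≡gcd[b²+1,x+bc]*gcd[x,c]²
  where
  c = b ∸ y
  b≡y+c : b ≡ y + c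
  b≡y+c = sym (m+[n∸m]≡n (<⇒≤ y<b))
  2≤n : 2 ≤ x + b * y
  2≤n = ≤∧≢⇒< (OneCycle.positive cycle) (≢-sym n≢1)
  cycleEq : x ^ 2 ≡ x + y * c
  cycleEq = Equivalence.to (twoDigitFixedPoint⇔cycleEquation b≡y+c)
              (trans (sym (S-twoDigits 2≤b x<b y<b 2≤n)) (OneCycle.fixed cycle))
  0<y : 0 < y
  0<y = cycleEquation-nontrivial⇒0<y {b} cycleEq 2≤n
  instance
    y≢0 : NonZero y
    y≢0 = >-nonZero 0<y
    c≢0 : NonZero c
    c≢0 = >-nonZero (m<n⇒0<n∸m y<b)
  cycle′ : OneCycle b (x + b * c)
  cycle′ = twoDigitCycle 2≤b x<b (∸-monoʳ-< 0<y (<⇒≤ y<b))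
             (Equivalence.from (twoDigitFixedPoint⇔cycleEquation (trans b≡y+c (+-comm y c)))
               (trans cycleEq (cong (x +_) (*-comm y c))))
  open CycleEquation {b} {x} {y} {c} b≡y+c cycleEq
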